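{- Let $k$ and $s$ be positive integers. If the group $G=\mathbb{Z}_2\times\mathbb{Z}_{2k}$ has an $s$-spanning set of size $2$, then $|G|\le 2s^2$.
   Context: $\mathbb{Z}_n=\mathbb{Z}/n\mathbb{Z}$. A subset $A=\{a_1,a_2\}$ of an abelian group $G$ is an $s$-spanning set if every element of $G$ equals $\lambda_1a_1+\lambda_2a_2$ for some integers $\lambda_1,\lambda_2$ with $|\lambda_1|+|\lambda_2|\le s$. -}

module Defs where

open import Data.Nat using (ℕ; suc; _*_)
open import Data.Fin using (Fin; toℕ)
open import Data.Integer as ℤ using (ℤ; +_)
open import Data.Integer.Divisibility using (_∣_)
open import Data.Product using (_×_; _,_; proj₁; proj₂; ∃₂)
open import Data.Nat as ℕ using (_≤_)
open import Relation.Binary.PropositionalEquality using (_≡_)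
open import Relation.Nullary using (¬_)

_≡_[mod_] : ℤ → ℤ → ℕ → Set
a ≡ b [mod n ] = (+ n) ∣ (a ℤ.- b)

G : ℕ → Set
G k = Fin 2 × Fin (2 * k)

c₁ : ∀ k → G k → ℤ
c₁ k g = + toℕ (proj₁ g)

c₂ : ∀ k → G k → ℤ
c₂ k g = + toℕ (proj₂ g)

IsComb : ∀ k → G k → ℤ → G k → ℤ → G k → Set
IsComb k g l₁ a₁ l₂ a₂ =
  (c₁ k g ≡ l₁ ℤ.* c₁ k a₁ ℤ.+ l₂ ℤ.* c₁ k a₂ [mod 2 ]) ×
  (c₂ k g ≡ l₁ ℤ.* c₂ k a₁ ℤ.+ l₂ ℤ.* c₂ k a₂ [mod (2 * k) ])

SSpanning₂ : ∀ k → ℕ → G k → G k → Set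
SSpanning₂ k s a₁ a₂ =
  ∀ (g : G k) → ∃₂ λ (l₁ l₂ : ℤ) →
    (ℤ.∣ l₁ ∣ ℕ.+ ℤ.∣ l₂ ∣ ≤ s) × IsComb k g l₁ a₁ l₂ a₂

HasSSpanningSetOfSize2 : ∀ k → ℕ → Set
HasSSpanningSetOfSize2 k s =
  ∃₂ λ (a₁ a₂ : G k) → ¬ (a₁ ≡ a₂) × SSpanning₂ k s a₁ a₂

orderG : ℕ → ℕ
orderG k = 2 * (2 * k)

module Submission where

-- Write u, v ∈ ℤ² for the integer representatives of a₁, a₂ and δ = det (u , v).
-- The functional ψ z = det (z , u + v) satisfies ψ (λ₁ u + λ₂ v) = (λ₁ − λ₂) δ, and
-- δ is odd because a₁, a₂ generate G / 2G ≅ ℤ₂². Reducing mod 2, every element g of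
-- the fibre ψ g ≡ (1 − s) δ (mod 2), which consists of two cosets of 2G and so has
-- 2k elements, is λ₁ a₁ + λ₂ a₂ with |λ₁| + |λ₂| ≤ s and λ₁ − λ₂ ≡ 1 − s (mod 2).
-- Then λ₁ + λ₂ + s and λ₁ − λ₂ + s are odd numbers in [0, 2s], i.e. 2A + 1 and
-- 2B + 1 with A, B < s, and g ↦ (A , B) is injective. Hence 2k ≤ s², so
-- |G| = 4k ≤ 2s².

open import Defs
open import Data.Nat as ℕ using (ℕ; zero; suc; _*_; _≤_; _<_; NonZero)
import Data.Nat.Properties as ℕP
import Data.Nat.Divisibility as ℕD
open import Data.Nat.DivMod using (m<n⇒m%n≡m)
open import Data.Integer as ℤ using (ℤ; +_; ∣_∣)
import Data.Integer.Properties as ℤP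
open import Data.Integer.DivMod using (_%ℕ_; _/ℕ_; n%ℕd<d; a≡a%ℕn+[a/ℕn]*n)
import Data.Integer.Divisibility.Signed as Sg
open import Data.Integer.Tactic.RingSolver using (solve-∀)
open import Data.Fin as Fin using (Fin; toℕ; fromℕ<; combine; cast; remQuot)
import Data.Fin.Properties as FinP
open import Data.Product using (Σ; _×_; _,_; proj₁; proj₂; uncurry)
open import Data.Sum using (inj₁; inj₂)
open import Function using (_∘_)
open import Relation.Binary.Bundles using (Setoid)
import Relation.Binary.Reasoning.Setoid
open import Relation.Binary.PropositionalEquality

-- `_≡_[mod_]` unfolds to divisibility of an absolute value, from which Agda cannot
-- recover its two sides; this record keeps them visible to unification.
infix 4 _≈_[mod_]
record _≈_[mod_] (a b : ℤ) (n : ℕ) : Set where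
  constructor ≈[mod]-intro
  field divides-difference : + n Sg.∣ (a ℤ.- b)
open _≈_[mod_]

module _ {n : ℕ} where

  ≡[mod]⇒≈[mod] : ∀ {a b} → a ≡ b [mod n ] → a ≈ b [mod n ]
  ≡[mod]⇒≈[mod] p = ≈[mod]-intro (Sg.∣ᵤ⇒∣ p)

  ≈[mod]⇒≡[mod] : ∀ {a b} → a ≈ b [mod n ] → a ≡ b [mod n ]
  ≈[mod]⇒≡[mod] p = Sg.∣⇒∣ᵤ (divides-difference p)

  ≈[mod]-reflexive : ∀ {a b} → a ≡ b → a ≈ b [mod n ]
  ≈[mod]-reflexive {a} refl = ≈[mod]-intro (Sg.divides (+ 0) (ℤP.+-inverseʳ a))

  ≈[mod]-sym : ∀ {a b} → a ≈ b [mod n ] → b ≈ a [mod n ]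
  ≈[mod]-sym {a} {b} (≈[mod]-intro p) =
    ≈[mod]-intro (subst (+ n Sg.∣_) (negate a b) (Sg.∣m⇒∣-m p))
    where
    negate : ∀ a b → ℤ.- (a ℤ.- b) ≡ b ℤ.- a
    negate = solve-∀

  ≈[mod]-trans : ∀ {a b c} → a ≈ b [mod n ] → b ≈ c [mod n ] → a ≈ c [mod n ]
  ≈[mod]-trans {a} {b} {c} (≈[mod]-intro p) (≈[mod]-intro q) =
    ≈[mod]-intro (subst (+ n Sg.∣_) (telescope a b c) (Sg.∣m∣n⇒∣m+n p q))
    where
    telescope : ∀ a b c → (a ℤ.- b) ℤ.+ (b ℤ.- c) ≡ a ℤ.- c
    telescope = solve-∀

  ≈[mod]-setoid : Setoid _ _
  ≈[mod]-setoid = record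
    { Carrier       = ℤ
    ; _≈_           = _≈_[mod n ]
    ; isEquivalence = record { refl = ≈[mod]-reflexive refl ; sym = ≈[mod]-sym ; trans = ≈[mod]-trans }
    }

  -‿≈[mod]-cong : ∀ {a b c d} → a ≈ b [mod n ] → c ≈ d [mod n ] → a ℤ.- c ≈ b ℤ.- d [mod n ]
  -‿≈[mod]-cong {a} {b} {c} {d} (≈[mod]-intro p) (≈[mod]-intro q) =
    ≈[mod]-intro (subst (+ n Sg.∣_) (regroup a b c d) (Sg.∣m∣n⇒∣m-n p q))
    where
    regroup : ∀ a b c d → (a ℤ.- b) ℤ.- (c ℤ.- d) ≡ (a ℤ.- c) ℤ.- (b ℤ.- d)
    regroup = solve-∀

  *-≈[mod]-cong : ∀ {a b c d} → a ≈ b [mod n ] → c ≈ d [mod n ] → a ℤ.* c ≈ b ℤ.* d [mod n ]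
  *-≈[mod]-cong {a} {b} {c} {d} (≈[mod]-intro p) (≈[mod]-intro q) =
    ≈[mod]-intro (subst (+ n Sg.∣_) (regroup a b c d)
      (Sg.∣m∣n⇒∣m+n (Sg.∣m⇒∣m*n c p) (Sg.∣n⇒∣m*n b q)))
    where
    regroup : ∀ a b c d → (a ℤ.- b) ℤ.* c ℤ.+ b ℤ.* (c ℤ.- d) ≡ a ℤ.* c ℤ.- b ℤ.* d
    regroup = solve-∀

  ≈[mod]-cancel-unit : ∀ m d a b →
    m ℤ.* d ≈ + 1 [mod n ] → a ℤ.* d ≈ b ℤ.* d [mod n ] → a ≈ b [mod n ]
  ≈[mod]-cancel-unit m d a b (≈[mod]-intro unit) (≈[mod]-intro p) =
    ≈[mod]-intro (subst (+ n Sg.∣_) (regroup m d a b)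
      (Sg.∣m∣n⇒∣m-n (Sg.∣n⇒∣m*n m p) (Sg.∣m⇒∣m*n (a ℤ.- b) unit)))
    where
    regroup : ∀ m d a b →
      m ℤ.* (a ℤ.* d ℤ.- b ℤ.* d) ℤ.- (m ℤ.* d ℤ.- + 1) ℤ.* (a ℤ.- b) ≡ a ℤ.- b
    regroup = solve-∀

  ≈[mod]-%ℕ : ∀ .{{_ : NonZero n}} x → x ≈ + (x %ℕ n) [mod n ]
  ≈[mod]-%ℕ x = ≈[mod]-intro (Sg.divides (x /ℕ n) (begin
    x ℤ.- + r                        ≡⟨ cong (ℤ._- + r) (a≡a%ℕn+[a/ℕn]*n x n) ⟩
    + r ℤ.+ (x /ℕ n) ℤ.* + n ℤ.- + r ≡⟨ cancel (+ r) ((x /ℕ n) ℤ.* + n) ⟩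
    (x /ℕ n) ℤ.* + n                 ∎))
    where
    open ≡-Reasoning
    r = x %ℕ n
    cancel : ∀ r q → r ℤ.+ q ℤ.- r ≡ q
    cancel = solve-∀

  +multiple-≈[mod] : ∀ q r → + (n * q ℕ.+ r) ≈ + r [mod n ]
  +multiple-≈[mod] q r = ≈[mod]-intro (Sg.divides (+ q) (begin
    + (n * q ℕ.+ r) ℤ.- + r    ≡⟨ cong (ℤ._- + r) (ℤP.pos-+ (n * q) r) ⟩
    + (n * q) ℤ.+ + r ℤ.- + r  ≡⟨ cancel (+ (n * q)) (+ r) ⟩
    + (n * q)                  ≡⟨ ℤP.pos-* n q ⟩
    + n ℤ.* + q                ≡⟨ ℤP.*-comm (+ n) (+ q) ⟩
    + q ℤ.* + n                ∎))
    where
    open ≡-Reasoning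
    cancel : ∀ a r → a ℤ.+ r ℤ.- r ≡ a
    cancel = solve-∀

≈[mod]-weaken : ∀ {d n a b} → d ℕD.∣ n → a ≈ b [mod n ] → a ≈ b [mod d ]
≈[mod]-weaken d∣n p = ≡[mod]⇒≈[mod] (ℕD.∣-trans d∣n (≈[mod]⇒≡[mod] p))

<∧∣⇒≡0 : ∀ {m n} → m < n → n ℕD.∣ m → m ≡ 0
<∧∣⇒≡0 {n = suc _} m<n n∣m = trans (sym (m<n⇒m%n≡m m<n)) (ℕD.n∣m⇒m%n≡0 _ _ n∣m)

≥-+-≈[mod]-injective : ∀ {n a b} → b ≤ a → a < n → + a ≈ + b [mod n ] → a ≡ b
≥-+-≈[mod]-injective {n} {a} {b} b≤a a<n a≈b =
  ℕP.≤-antisym (ℕP.m∸n≡0⇒m≤n (<∧∣⇒≡0 (ℕP.≤-<-trans (ℕP.m∸n≤m a b) a<n) n∣a∸b)) b≤a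
  where
  n∣a∸b : n ℕD.∣ a ℕ.∸ b
  n∣a∸b = subst (n ℕD.∣_) (cong ∣_∣ (trans (ℤP.[+m]-[+n]≡m⊖n a b) (ℤP.⊖-≥ b≤a)))
    (≈[mod]⇒≡[mod] a≈b)

+-≈[mod]-injective : ∀ {n a b} → a < n → b < n → + a ≈ + b [mod n ] → a ≡ b
+-≈[mod]-injective {a = a} {b} a<n b<n a≈b with ℕP.≤-total b a
... | inj₁ b≤a = ≥-+-≈[mod]-injective b≤a a<n a≈b
... | inj₂ a≤b = sym (≥-+-≈[mod]-injective a≤b b<n (≈[mod]-sym a≈b))

toℕ-≈[mod]-injective : ∀ {n} (i j : Fin n) → + toℕ i ≈ + toℕ j [mod n ] → i ≡ j
toℕ-≈[mod]-injective i j i≈j =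
  FinP.toℕ-injective (+-≈[mod]-injective (FinP.toℕ<n i) (FinP.toℕ<n j) i≈j)

residue : ∀ n .{{_ : NonZero n}} → ℤ → Fin n
residue n x = fromℕ< (n%ℕd<d x n)

≈[mod]-residue : ∀ {n} .{{_ : NonZero n}} x → x ≈ + toℕ (residue n x) [mod n ]
≈[mod]-residue {n} x =
  subst (λ r → x ≈ + r [mod n ]) (sym (FinP.toℕ-fromℕ< (n%ℕd<d x n))) (≈[mod]-%ℕ x)

det : ℤ × ℤ → ℤ × ℤ → ℤ
det (x , y) (x′ , y′) = x ℤ.* y′ ℤ.- y ℤ.* x′

comb : ℤ → ℤ × ℤ → ℤ → ℤ × ℤ → ℤ × ℤ
comb a (x , y) b (x′ , y′) = a ℤ.* x ℤ.+ b ℤ.* x′ , a ℤ.* y ℤ.+ b ℤ.* y′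

det-comb : ∀ a b c d u v → det (comb a u b v) (comb c u d v) ≡ (a ℤ.* d ℤ.- b ℤ.* c) ℤ.* det u v
det-comb a b c d (x , y) (x′ , y′) = multiplicative a b c d x y x′ y′
  where
  multiplicative : ∀ a b c d x y x′ y′ →
    (a ℤ.* x ℤ.+ b ℤ.* x′) ℤ.* (c ℤ.* y ℤ.+ d ℤ.* y′) ℤ.- (a ℤ.* y ℤ.+ b ℤ.* y′) ℤ.* (c ℤ.* x ℤ.+ d ℤ.* x′)
      ≡ (a ℤ.* d ℤ.- b ℤ.* c) ℤ.* (x ℤ.* y′ ℤ.- y ℤ.* x′)
  multiplicative = solve-∀

det-comb-sum : ∀ a b u v → det (comb a u b v) (comb (+ 1) u (+ 1) v) ≡ (a ℤ.- b) ℤ.* det u v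
det-comb-sum a b u v = trans (det-comb a b (+ 1) (+ 1) u v) (cong (ℤ._* det u v) (simplify a b))
  where
  simplify : ∀ a b → a ℤ.* + 1 ℤ.- b ℤ.* + 1 ≡ a ℤ.- b
  simplify = solve-∀

det-comb-second : ∀ a b u v → det (comb (+ 1) u (+ 0) v) (comb a u b v) ≡ b ℤ.* det u v
det-comb-second a b u v = trans (det-comb (+ 1) (+ 0) a b u v) (cong (ℤ._* det u v) (simplify a b))
  where
  simplify : ∀ a b → + 1 ℤ.* b ℤ.- + 0 ℤ.* a ≡ b
  simplify = solve-∀

infix 4 _≈²_[mod_]
_≈²_[mod_] : ℤ × ℤ → ℤ × ℤ → ℕ → Set
(x , y) ≈² (x′ , y′) [mod n ] = x ≈ x′ [mod n ] × y ≈ y′ [mod n ]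

≈²[mod]-refl : ∀ {n} z → z ≈² z [mod n ]
≈²[mod]-refl (x , y) = ≈[mod]-reflexive refl , ≈[mod]-reflexive refl

≈²[mod]-sym : ∀ {n} z w → z ≈² w [mod n ] → w ≈² z [mod n ]
≈²[mod]-sym (x , y) (x′ , y′) (x≈ , y≈) = ≈[mod]-sym x≈ , ≈[mod]-sym y≈

≈²[mod]-trans : ∀ {n} z w t → z ≈² w [mod n ] → w ≈² t [mod n ] → z ≈² t [mod n ]
≈²[mod]-trans (x , y) (x′ , y′) (x″ , y″) (x≈ , y≈) (x≈′ , y≈′) =
  ≈[mod]-trans x≈ x≈′ , ≈[mod]-trans y≈ y≈′

det-≈[mod]-cong : ∀ {n} z z′ w w′ →
  z ≈² z′ [mod n ] → w ≈² w′ [mod n ] → det z w ≈ det z′ w′ [mod n ]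
det-≈[mod]-cong (x , y) (x′ , y′) (X , Y) (X′ , Y′) (x≈ , y≈) (X≈ , Y≈) =
  -‿≈[mod]-cong (*-≈[mod]-cong x≈ Y≈) (*-≈[mod]-cong y≈ X≈)

embed : ∀ {n} → Fin n × Fin n → ℤ × ℤ
embed (x , y) = + toℕ x , + toℕ y

residue² : ∀ n .{{_ : NonZero n}} → ℤ × ℤ → Fin n × Fin n
residue² n (x , y) = residue n x , residue n y

≈²[mod]-residue² : ∀ {n} .{{_ : NonZero n}} z → z ≈² embed (residue² n z) [mod n ]
≈²[mod]-residue² (x , y) = ≈[mod]-residue x , ≈[mod]-residue y

nonNegative-shift : ∀ s X → ∣ X ∣ ≤ s → Σ ℕ λ a → (+ a ≡ X ℤ.+ + s) × (a ≤ s ℕ.+ s)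
nonNegative-shift s (+ n)      n≤s   = n ℕ.+ s , ℤP.pos-+ n s , ℕP.+-monoˡ-≤ s n≤s
nonNegative-shift s ℤ.-[1+ n ] 1+n≤s =
  s ℕ.∸ suc n ,
  sym (trans (ℤP.-m+n≡n⊖m (suc n) s) (ℤP.⊖-≥ 1+n≤s)) ,
  ℕP.≤-trans (ℕP.m∸n≤m s (suc n)) (ℕP.m≤m+n s s)

odd⇒suc-double : ∀ a → + a ≈ + 1 [mod 2 ] → Σ ℕ λ A → a ≡ suc (A * 2)
odd⇒suc-double 0       a≈1 with () ← ℕD.∣1⇒≡1 (≈[mod]⇒≡[mod] a≈1)
odd⇒suc-double (suc a) a≈1 with ℕD.divides A a≡A*2 ← ≈[mod]⇒≡[mod] a≈1 = A , cong suc a≡A*2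

ball-coordinate : ∀ s X → ∣ X ∣ ≤ s → X ≈ + 1 ℤ.- + s [mod 2 ] →
  Σ (Fin s) λ A → X ≡ + suc (toℕ A * 2) ℤ.- + s
ball-coordinate s X ∣X∣≤s (≈[mod]-intro 2∣X-[1-s]) = fromℕ< A<s , X≡1+2A-s
  where
  shifted = nonNegative-shift s X ∣X∣≤s
  a = proj₁ shifted
  a≡X+s : + a ≡ X ℤ.+ + s
  a≡X+s = proj₁ (proj₂ shifted)
  regroup : ∀ x s → x ℤ.- (+ 1 ℤ.- s) ≡ x ℤ.+ s ℤ.- + 1
  regroup = solve-∀
  a≈1 : + a ≈ + 1 [mod 2 ]
  a≈1 = ≈[mod]-intro
    (subst (+ 2 Sg.∣_) (trans (regroup X (+ s)) (cong (ℤ._- + 1) (sym a≡X+s))) 2∣X-[1-s])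
  odd = odd⇒suc-double a a≈1
  A = proj₁ odd
  A<s : A < s
  A<s = ℕP.*-cancelʳ-< 2 A s (begin-strict
    A * 2       <⟨ ℕP.n<1+n (A * 2) ⟩
    suc (A * 2) ≡⟨ proj₂ odd ⟨
    a           ≤⟨ proj₂ (proj₂ shifted) ⟩
    s ℕ.+ s     ≡⟨ cong (s ℕ.+_) (ℕP.+-identityʳ s) ⟨
    2 * s       ≡⟨ ℕP.*-comm 2 s ⟩
    s * 2       ∎)
    where open ℕP.≤-Reasoning
  unshift : ∀ x s → x ≡ x ℤ.+ s ℤ.- s
  unshift = solve-∀
  X≡1+2A-s : X ≡ + suc (toℕ (fromℕ< A<s) * 2) ℤ.- + s
  X≡1+2A-s = begin
    X                                    ≡⟨ unshift X (+ s) ⟩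
    X ℤ.+ + s ℤ.- + s                    ≡⟨ cong (ℤ._- + s) a≡X+s ⟨
    + a ℤ.- + s                          ≡⟨ cong (λ a → + a ℤ.- + s) (proj₂ odd) ⟩
    + suc (A * 2) ℤ.- + s                ≡⟨ cong (λ A → + suc (A * 2) ℤ.- + s) (FinP.toℕ-fromℕ< A<s) ⟨
    + suc (toℕ (fromℕ< A<s) * 2) ℤ.- + s ∎
    where open ≡-Reasoning

sum-≈-difference[mod2] : ∀ a b → a ℤ.+ b ≈ a ℤ.- b [mod 2 ]
sum-≈-difference[mod2] a b = ≈[mod]-intro (Sg.divides b (regroup a b))
  where
  regroup : ∀ a b → a ℤ.+ b ℤ.- (a ℤ.- b) ≡ b ℤ.* + 2
  regroup = solve-∀

sum-difference-injective : ∀ {a b a′ b′} →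
  a ℤ.+ b ≡ a′ ℤ.+ b′ → a ℤ.- b ≡ a′ ℤ.- b′ → a ≡ a′ × b ≡ b′
sum-difference-injective {a} {b} {a′} {b′} sum≡ difference≡ =
  ℤP.*-cancelʳ-≡ a a′ (+ 2) (begin
    a ℤ.* + 2                     ≡⟨ double a b ⟩
    (a ℤ.+ b) ℤ.+ (a ℤ.- b)       ≡⟨ cong₂ ℤ._+_ sum≡ difference≡ ⟩
    (a′ ℤ.+ b′) ℤ.+ (a′ ℤ.- b′)   ≡⟨ double a′ b′ ⟨
    a′ ℤ.* + 2                    ∎) ,
  ℤP.*-cancelʳ-≡ b b′ (+ 2) (begin
    b ℤ.* + 2                     ≡⟨ double′ a b ⟩
    (a ℤ.+ b) ℤ.- (a ℤ.- b)       ≡⟨ cong₂ ℤ._-_ sum≡ difference≡ ⟩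
    (a′ ℤ.+ b′) ℤ.- (a′ ℤ.- b′)   ≡⟨ double′ a′ b′ ⟨
    b′ ℤ.* + 2                    ∎)
  where
  open ≡-Reasoning
  double : ∀ a b → a ℤ.* + 2 ≡ (a ℤ.+ b) ℤ.+ (a ℤ.- b)
  double = solve-∀
  double′ : ∀ a b → b ℤ.* + 2 ≡ (a ℤ.+ b) ℤ.- (a ℤ.- b)
  double′ = solve-∀

module _ (s : ℕ) (l₁ l₂ : ℤ)
         (bounded : ∣ l₁ ∣ ℕ.+ ∣ l₂ ∣ ≤ s) (parity : l₁ ℤ.- l₂ ≈ + 1 ℤ.- + s [mod 2 ]) where

  sum-coordinate : Σ (Fin s) λ A → l₁ ℤ.+ l₂ ≡ + suc (toℕ A * 2) ℤ.- + s
  sum-coordinate = ball-coordinate s (l₁ ℤ.+ l₂) (ℕP.≤-trans (ℤP.∣i+j∣≤∣i∣+∣j∣ l₁ l₂) bounded)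
    (≈[mod]-trans (sum-≈-difference[mod2] l₁ l₂) parity)

  difference-coordinate : Σ (Fin s) λ B → l₁ ℤ.- l₂ ≡ + suc (toℕ B * 2) ℤ.- + s
  difference-coordinate =
    ball-coordinate s (l₁ ℤ.- l₂) (ℕP.≤-trans (ℤP.∣i-j∣≤∣i∣+∣j∣ l₁ l₂) bounded) parity

  ball-code : Fin (s * s)
  ball-code = combine (proj₁ sum-coordinate) (proj₁ difference-coordinate)

ball-code-injective : ∀ s l₁ l₂ l₁′ l₂′ b p b′ p′ →
  ball-code s l₁ l₂ b p ≡ ball-code s l₁′ l₂′ b′ p′ → l₁ ≡ l₁′ × l₂ ≡ l₂′
ball-code-injective s l₁ l₂ l₁′ l₂′ b p b′ p′ eq with FinP.combine-injective _ _ _ _ eq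
... | A≡A′ , B≡B′ = sum-difference-injective
  (same-coordinate (sum-coordinate s l₁ l₂ b p) (sum-coordinate s l₁′ l₂′ b′ p′) A≡A′)
  (same-coordinate (difference-coordinate s l₁ l₂ b p) (difference-coordinate s l₁′ l₂′ b′ p′) B≡B′)
  where
  same-coordinate : ∀ {X X′} →
    (c : Σ (Fin s) λ A → X ≡ + suc (toℕ A * 2) ℤ.- + s) →
    (c′ : Σ (Fin s) λ A → X′ ≡ + suc (toℕ A * 2) ℤ.- + s) →
    proj₁ c ≡ proj₁ c′ → X ≡ X′
  same-coordinate (A , X≡) (.A , X′≡) refl = trans X≡ (sym X′≡)

point : ∀ k → G k → ℤ × ℤ
point k g = c₁ k g , c₂ k g

module Combination (k : ℕ) (a₁ a₂ : G k) where

  isComb⇒≈ : ∀ g l₁ l₂ → IsComb k g l₁ a₁ l₂ a₂ →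
    let (x , y) = comb l₁ (point k a₁) l₂ (point k a₂) in
    c₁ k g ≈ x [mod 2 ] × c₂ k g ≈ y [mod 2 * k ]
  isComb⇒≈ g l₁ l₂ (first , second) =
    ≡[mod]⇒≈[mod] {a = c₁ k g} {l₁ ℤ.* c₁ k a₁ ℤ.+ l₂ ℤ.* c₁ k a₂} first ,
    ≡[mod]⇒≈[mod] {a = c₂ k g} {l₁ ℤ.* c₂ k a₁ ℤ.+ l₂ ℤ.* c₂ k a₂} second

  isComb⇒≈² : ∀ g l₁ l₂ → IsComb k g l₁ a₁ l₂ a₂ →
    point k g ≈² comb l₁ (point k a₁) l₂ (point k a₂) [mod 2 ]
  isComb⇒≈² g l₁ l₂ comb-g with first , second ← isComb⇒≈ g l₁ l₂ comb-g =
    first , ≈[mod]-weaken (ℕD.divides k (ℕP.*-comm 2 k)) second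

  isComb-unique : ∀ g g′ l₁ l₂ → IsComb k g l₁ a₁ l₂ a₂ → IsComb k g′ l₁ a₁ l₂ a₂ → g ≡ g′
  isComb-unique g g′ l₁ l₂ comb-g comb-g′
    with first , second ← isComb⇒≈ g l₁ l₂ comb-g | first′ , second′ ← isComb⇒≈ g′ l₁ l₂ comb-g′ =
    cong₂ _,_
      (toℕ-≈[mod]-injective (proj₁ g) (proj₁ g′) (≈[mod]-trans first (≈[mod]-sym first′)))
      (toℕ-≈[mod]-injective (proj₂ g) (proj₂ g′) (≈[mod]-trans second (≈[mod]-sym second′)))

-- (x , 2i + y): as i ranges over Fin k, the k elements of G k with residues (x , y) mod 2.
lift : ∀ k → Fin 2 × Fin 2 → Fin k → G k
lift k (x , y) i = x , cast (ℕP.*-comm k 2) (combine i y)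

point-lift : ∀ k r i → point k (lift k r i) ≈² embed r [mod 2 ]
point-lift k (x , y) i =
  ≈[mod]-reflexive refl ,
  subst (λ t → + t ≈ + toℕ y [mod 2 ])
    (sym (trans (FinP.toℕ-cast _ (combine i y)) (FinP.toℕ-combine i y)))
    (+multiple-≈[mod] (toℕ i) (toℕ y))

lift-injective : ∀ k r r′ i i′ → lift k r i ≡ lift k r′ i′ → r ≡ r′ × i ≡ i′
lift-injective k (x , y) (x′ , y′) i i′ eq with FinP.combine-injective i y i′ y′ combine≡
  where
  combine≡ : combine i y ≡ combine i′ y′
  combine≡ = FinP.toℕ-injective (begin
    toℕ (combine i y)                          ≡⟨ FinP.toℕ-cast _ (combine i y) ⟨
    toℕ (cast (ℕP.*-comm k 2) (combine i y))   ≡⟨ cong (toℕ ∘ proj₂) eq ⟩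
    toℕ (cast (ℕP.*-comm k 2) (combine i′ y′)) ≡⟨ FinP.toℕ-cast _ (combine i′ y′) ⟩
    toℕ (combine i′ y′)                        ∎)
    where open ≡-Reasoning
... | i≡i′ , y≡y′ = cong₂ _,_ (cong proj₁ eq) y≡y′ , i≡i′

module SpanningSet {k′ s : ℕ} {a₁ a₂ : G (suc k′)} (spanning : SSpanning₂ (suc k′) s a₁ a₂) where

  private
    k = suc k′
    module ≈₂ = Relation.Binary.Reasoning.Setoid (≈[mod]-setoid {2})
  open Combination k a₁ a₂

  u v w : ℤ × ℤ
  u = point k a₁
  v = point k a₂
  w = comb (+ 1) u (+ 1) v

  δ : ℤ
  δ = det u v

  ψ : ℤ × ℤ → ℤ
  ψ z = det z w

  coefficient₁ coefficient₂ : G k → ℤ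
  coefficient₁ g = proj₁ (spanning g)
  coefficient₂ g = proj₁ (proj₂ (spanning g))

  coefficients-bounded : ∀ g → ∣ coefficient₁ g ∣ ℕ.+ ∣ coefficient₂ g ∣ ≤ s
  coefficients-bounded g = proj₁ (proj₂ (proj₂ (spanning g)))

  coefficients-comb : ∀ g → IsComb k g (coefficient₁ g) a₁ (coefficient₂ g) a₂
  coefficients-comb g = proj₂ (proj₂ (proj₂ (spanning g)))

  ψ-point : ∀ g l₁ l₂ → IsComb k g l₁ a₁ l₂ a₂ → ψ (point k g) ≈ (l₁ ℤ.- l₂) ℤ.* δ [mod 2 ]
  ψ-point g l₁ l₂ comb-g = ≈[mod]-trans
    (det-≈[mod]-cong (point k g) (comb l₁ u l₂ v) w w (isComb⇒≈² g l₁ l₂ comb-g) (≈²[mod]-refl w))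
    (≈[mod]-reflexive (det-comb-sum l₁ l₂ u v))

  det-unit : Σ ℤ λ m → m ℤ.* δ ≈ + 1 [mod 2 ]
  det-unit = L₁ ℤ.* M₂ ℤ.- L₂ ℤ.* M₁ , ≈[mod]-sym (begin
    + 1                                   ≡⟨ cong (λ t → + 1 ℤ.* + t ℤ.- + 0 ℤ.* + 0) 1≡toℕ ⟩
    det (point k e₁) (point k e₂)         ≈⟨ det-≈[mod]-cong _ (comb L₁ u L₂ v) _ (comb M₁ u M₂ v)
                                               (isComb⇒≈² e₁ L₁ L₂ (coefficients-comb e₁))
                                               (isComb⇒≈² e₂ M₁ M₂ (coefficients-comb e₂)) ⟩
    det (comb L₁ u L₂ v) (comb M₁ u M₂ v) ≡⟨ det-comb L₁ L₂ M₁ M₂ u v ⟩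
    (L₁ ℤ.* M₂ ℤ.- L₂ ℤ.* M₁) ℤ.* δ       ∎)
    where
    open ≈₂
    1<2k : 1 < 2 * k
    1<2k = ℕP.*-monoʳ-≤ 2 (ℕ.s≤s ℕ.z≤n)
    e₁ e₂ : G k
    e₁ = Fin.suc Fin.zero , Fin.zero
    e₂ = Fin.zero , fromℕ< 1<2k
    1≡toℕ : 1 ≡ toℕ (proj₂ e₂)
    1≡toℕ = sym (FinP.toℕ-fromℕ< 1<2k)
    L₁ = coefficient₁ e₁
    L₂ = coefficient₂ e₁
    M₁ = coefficient₁ e₂
    M₂ = coefficient₂ e₂

  -- Chosen so that λ₁ − λ₂ ≡ c (mod 2) makes λ₁ ± λ₂ + s odd.
  c : ℤ
  c = + 1 ℤ.- + s

  InFiber : G k → Set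
  InFiber g = ψ (point k g) ≈ c ℤ.* δ [mod 2 ]

  fiber-coefficients : ∀ g l₁ l₂ → InFiber g → IsComb k g l₁ a₁ l₂ a₂ → l₁ ℤ.- l₂ ≈ c [mod 2 ]
  fiber-coefficients g l₁ l₂ g∈F comb-g =
    ≈[mod]-cancel-unit (proj₁ det-unit) δ (l₁ ℤ.- l₂) c (proj₂ det-unit)
      (≈[mod]-trans (≈[mod]-sym (ψ-point g l₁ l₂ comb-g)) g∈F)

  representative : Fin 2 → ℤ × ℤ
  representative b = comb (c ℤ.+ + toℕ b) u (+ toℕ b) v

  ψ-representative : ∀ b → ψ (representative b) ≡ c ℤ.* δ
  ψ-representative b =
    trans (det-comb-sum (c ℤ.+ + toℕ b) (+ toℕ b) u v) (cong (ℤ._* δ) (cancel c (+ toℕ b)))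
    where
    cancel : ∀ c b → c ℤ.+ b ℤ.- b ≡ c
    cancel = solve-∀

  -- The two residue classes modulo 2 making up the fibre; the coefficient of v tells
  -- them apart, and it is read off with det (u , _) since δ is odd.
  class : Fin 2 → Fin 2 × Fin 2
  class b = residue² 2 (representative b)

  class-injective : ∀ b b′ → class b ≡ class b′ → b ≡ b′
  class-injective b b′ eq = toℕ-≈[mod]-injective b b′
    (≈[mod]-cancel-unit (proj₁ det-unit) δ (+ toℕ b) (+ toℕ b′) (proj₂ det-unit) (begin
      + toℕ b ℤ.* δ               ≡⟨ det-comb-second (c ℤ.+ + toℕ b) (+ toℕ b) u v ⟨
      det e (representative b)   ≈⟨ det-≈[mod]-cong e e (representative b) (representative b′)
                                      (≈²[mod]-refl e) rep≈rep′ ⟩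
      det e (representative b′)  ≡⟨ det-comb-second (c ℤ.+ + toℕ b′) (+ toℕ b′) u v ⟩
      + toℕ b′ ℤ.* δ              ∎))
    where
    open ≈₂
    e = comb (+ 1) u (+ 0) v
    rep≈rep′ : representative b ≈² representative b′ [mod 2 ]
    rep≈rep′ = ≈²[mod]-trans (representative b) (embed (class b)) (representative b′)
      (≈²[mod]-residue² (representative b))
      (subst (λ r → embed r ≈² representative b′ [mod 2 ]) (sym eq)
        (≈²[mod]-sym (representative b′) (embed (class b′)) (≈²[mod]-residue² (representative b′))))

  lift-inFiber : ∀ b i → InFiber (lift k (class b) i)
  lift-inFiber b i = begin
    ψ (point k g)         ≈⟨ det-≈[mod]-cong _ (representative b) w w point≈rep (≈²[mod]-refl w) ⟩
    ψ (representative b)  ≡⟨ ψ-representative b ⟩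
    c ℤ.* δ               ∎
    where
    open ≈₂
    g = lift k (class b) i
    point≈rep : point k g ≈² representative b [mod 2 ]
    point≈rep = ≈²[mod]-trans (point k g) (embed (class b)) (representative b) (point-lift k (class b) i)
      (≈²[mod]-sym (representative b) (embed (class b)) (≈²[mod]-residue² (representative b)))

  enumerate : Fin (2 * k) → G k
  enumerate j = lift k (class (proj₁ (remQuot {2} k j))) (proj₂ (remQuot {2} k j))

  enumerate-inFiber : ∀ j → InFiber (enumerate j)
  enumerate-inFiber j = lift-inFiber (proj₁ (remQuot {2} k j)) (proj₂ (remQuot {2} k j))

  enumerate-injective : ∀ j j′ → enumerate j ≡ enumerate j′ → j ≡ j′
  enumerate-injective j j′ eq with lift-injective k (class b) (class b′) i i′ eq
    where
    b = proj₁ (remQuot {2} k j)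
    i = proj₂ (remQuot {2} k j)
    b′ = proj₁ (remQuot {2} k j′)
    i′ = proj₂ (remQuot {2} k j′)
  ... | class≡ , i≡i′ = begin
    j                                  ≡⟨ FinP.combine-remQuot {2} k j ⟨
    uncurry combine (remQuot {2} k j)  ≡⟨ cong (uncurry combine) remQuot≡ ⟩
    uncurry combine (remQuot {2} k j′) ≡⟨ FinP.combine-remQuot {2} k j′ ⟩
    j′                                 ∎
    where
    open ≡-Reasoning
    remQuot≡ : remQuot {2} k j ≡ remQuot {2} k j′
    remQuot≡ = cong₂ _,_ (class-injective _ _ class≡) i≡i′

  coefficient-parity : ∀ j → coefficient₁ (enumerate j) ℤ.- coefficient₂ (enumerate j) ≈ c [mod 2 ]
  coefficient-parity j =
    fiber-coefficients g (coefficient₁ g) (coefficient₂ g) (enumerate-inFiber j) (coefficients-comb g)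
    where g = enumerate j

  code : Fin (2 * k) → Fin (s * s)
  code j = ball-code s (coefficient₁ (enumerate j)) (coefficient₂ (enumerate j))
    (coefficients-bounded (enumerate j)) (coefficient-parity j)

  code-injective : ∀ {j j′} → code j ≡ code j′ → j ≡ j′
  code-injective {j} {j′} eq = enumerate-injective j j′
    (isComb-unique g g′ (coefficient₁ g′) (coefficient₂ g′)
      (subst₂ (λ l₁ l₂ → IsComb k g l₁ a₁ l₂ a₂) (proj₁ same-coefficients) (proj₂ same-coefficients)
        (coefficients-comb g))
      (coefficients-comb g′))
    where
    g = enumerate j
    g′ = enumerate j′
    same-coefficients : coefficient₁ g ≡ coefficient₁ g′ × coefficient₂ g ≡ coefficient₂ g′
    same-coefficients =
      ball-code-injective s (coefficient₁ g) (coefficient₂ g) (coefficient₁ g′) (coefficient₂ g′)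
        (coefficients-bounded g) (coefficient-parity j) (coefficients-bounded g′) (coefficient-parity j′)
        eq

  fiber-bound : 2 * k ≤ s * s
  fiber-bound = FinP.injective⇒≤ code-injective

mainTheorem11 : (k s : ℕ) → 1 ≤ k → 1 ≤ s →
    HasSSpanningSetOfSize2 k s → orderG k ≤ 2 * (s * s)
mainTheorem11 zero     s () _ _
mainTheorem11 (suc k′) s _ _ (a₁ , a₂ , _ , spanning) = ℕP.*-monoʳ-≤ 2 (SpanningSet.fiber-bound spanning)
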